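{- For every $n\ge2$ there exist trees $T,T'\in\mathcal T_n$ and an integer $\ell\ge1$ such that $T'$ is obtained from $T$ by a sequence of $\ell$ left rotations (a chain of length $\ell$ in the Tamari lattice $\mathcal T_n$ from $T$ to $T'$), while $\mathrm{dist}(T,T')<12\ell/n$.
   Context: Trees: finite binary rooted trees; $\bullet$ is the one-leaf tree and $T_0\wedge T_1$ the tree with left subtree $T_0$ and right subtree $T_1$; the size is the number of internal nodes, and $\mathcal T_n$ is the set of size-$n$ trees. A left rotation replaces some subtree of the form $T_0\wedge(T_1\wedge T_2)$ by $(T_0\wedge T_1)\wedge T_2$; a right rotation is the inverse operation. The Tamari order on $\mathcal T_n$: $T\le T'$ iff $T'$ is obtained from $T$ by finitely many left rotations. For $T,T'\in\mathcal T_n$, $\mathrm{dist}(T,T')$ is the minimal number of rotations (left or right) needed to transform $T$ into $T'$. -}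

module Defs where

open import Data.Nat using (ℕ; zero; suc; _+_; _≤_)
open import Data.Product using (_×_)
open import Relation.Binary.PropositionalEquality using (_≡_)

infixr 6 _∧_
data Tree : Set where
  •   : Tree
  _∧_ : Tree → Tree → Tree

size : Tree → ℕ
size •       = 0
size (s ∧ t) = suc (size s + size t)

data LeftRot : Tree → Tree → Set where
  rot   : ∀ a b c → LeftRot (a ∧ (b ∧ c)) ((a ∧ b) ∧ c)
  congˡ : ∀ {s s′} t → LeftRot s s′ → LeftRot (s ∧ t) (s′ ∧ t)
  congʳ : ∀ s {t t′} → LeftRot t t′ → LeftRot (s ∧ t) (s ∧ t′)

data Rot : Tree → Tree → Set where
  left  : ∀ {s t} → LeftRot s t → Rot s t
  right : ∀ {s t} → LeftRot t s → Rot s t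

data LeftRots : ℕ → Tree → Tree → Set where
  done : ∀ {t} → LeftRots 0 t t
  step : ∀ {k s t u} → LeftRot s t → LeftRots k t u → LeftRots (suc k) s u

data Rots : ℕ → Tree → Tree → Set where
  done : ∀ {t} → Rots 0 t t
  step : ∀ {k s t u} → Rot s t → Rots k t u → Rots (suc k) s u

IsDist : Tree → Tree → ℕ → Set
IsDist T T′ d = Rots d T T′ × (∀ d′ → Rots d′ T T′ → d ≤ d′)

module Submission where

-- The witnesses are the two combs of size n = m + 1: the right comb
-- Rcomb n = • ∧ (• ∧ (… ∧ •)) and the left comb Lcomb n = ((• ∧ •) ∧ …) ∧ •.
--
-- Rcomb n reaches Lcomb n by a sequence of left rotations
--    of length triangle n = n(n-1)/2: inductively turn the right subtree
--    into a left comb, then sweep the root leaf down the left spine.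
--  * Short path.  The m rotations  L j ∧ R (1+i) ↦ L (1+j) ∧ R i  (each
--    a single left rotation at the root) already join the two combs.
--  * Lower bound.  The length of the right arm (the number of internal
--    nodes on the rightmost branch) changes by at most one per rotation;
--    it is n for Rcomb n and 1 for Lcomb n, so at least m rotations are
--    needed.  Hence dist(Rcomb n, Lcomb n) = m.
--  * Arithmetic.  d * n = m(m+1) = 2 * triangle n < 12 * triangle n,
--    since triangle n ≥ 1 once n ≥ 2.

open import Defs
open import Data.Nat using (ℕ; _*_; _<_; _≤_)
open import Data.Product using (Σ; _×_)
open import Relation.Binary.PropositionalEquality using (_≡_)

open import Data.Nat using (zero; suc; _+_; s≤s; z≤n; >-nonZero)
open import Data.Nat.Properties
open import Data.Product using (_,_; proj₁; proj₂)
open import Relation.Binary.PropositionalEquality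
  using (refl; sym; trans; cong; subst; module ≡-Reasoning)

Rcomb : ℕ → Tree
Rcomb zero    = •
Rcomb (suc n) = • ∧ Rcomb n

Lcomb : ℕ → Tree
Lcomb zero    = •
Lcomb (suc n) = Lcomb n ∧ •

size-Rcomb : ∀ n → size (Rcomb n) ≡ n
size-Rcomb zero    = refl
size-Rcomb (suc n) = cong suc (size-Rcomb n)

size-Lcomb : ∀ n → size (Lcomb n) ≡ n
size-Lcomb zero    = refl
size-Lcomb (suc n) = cong suc (trans (+-identityʳ (size (Lcomb n))) (size-Lcomb n))

_++_ : ∀ {a b s t u} → LeftRots a s t → LeftRots b t u → LeftRots (a + b) s u
done       ++ q = q
step r p   ++ q = step r (p ++ q)

inLeft : ∀ {k s s′} t → LeftRots k s s′ → LeftRots k (s ∧ t) (s′ ∧ t)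
inLeft t done       = done
inLeft t (step r p) = step (congˡ t r) (inLeft t p)

inRight : ∀ {k t t′} s → LeftRots k t t′ → LeftRots k (s ∧ t) (s ∧ t′)
inRight s done       = done
inRight s (step r p) = step (congʳ s r) (inRight s p)

toRots : ∀ {k s t} → LeftRots k s t → Rots k s t
toRots done       = done
toRots (step r p) = step (left r) (toRots p)

triangle : ℕ → ℕ
triangle zero    = 0
triangle (suc n) = triangle n + n

double-triangle : ∀ m → 2 * triangle (suc m) ≡ m * suc m
double-triangle zero    = refl
double-triangle (suc m) = begin
  2 * (triangle (suc m) + suc m)       ≡⟨ *-distribˡ-+ 2 (triangle (suc m)) (suc m) ⟩
  2 * triangle (suc m) + 2 * suc m     ≡⟨ cong (_+ 2 * suc m) (double-triangle m) ⟩
  m * suc m + 2 * suc m                ≡⟨ sym (*-distribʳ-+ (suc m) m 2) ⟩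
  (m + 2) * suc m                      ≡⟨ cong (_* suc m) (+-comm m 2) ⟩
  suc (suc m) * suc m                  ≡⟨ *-comm (suc (suc m)) (suc m) ⟩
  suc m * suc (suc m)                  ∎
  where open ≡-Reasoning

leaf-down-spine : ∀ k → LeftRots k (• ∧ Lcomb k) (Lcomb (suc k))
leaf-down-spine zero    = done
leaf-down-spine (suc k) = step (rot • (Lcomb k) •) (inLeft • (leaf-down-spine k))

comb-chain : ∀ n → LeftRots (triangle n) (Rcomb n) (Lcomb n)
comb-chain zero    = done
comb-chain (suc n) = inRight • (comb-chain n) ++ leaf-down-spine n

transfer : ∀ i j → LeftRots i (Lcomb j ∧ Rcomb i) (Lcomb (i + j) ∧ •)
transfer zero    j = done
transfer (suc i) j = step (rot (Lcomb j) • (Rcomb i))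
  (subst (λ x → LeftRots i (Lcomb (suc j) ∧ Rcomb i) (Lcomb x ∧ •))
         (+-suc i j) (transfer i (suc j)))

comb-shortcut : ∀ m → Rots m (Rcomb (suc m)) (Lcomb (suc m))
comb-shortcut m =
  subst (λ x → Rots m (Rcomb (suc m)) (Lcomb (suc x)))
        (+-identityʳ m) (toRots (transfer m 0))

-- Length of the rightmost branch, counted in internal nodes; its slow
-- variation under rotations yields the lower bound on the distance.
rightArm : Tree → ℕ
rightArm •       = 0
rightArm (s ∧ t) = suc (rightArm t)

rightArm-leftRot : ∀ {s t} → LeftRot s t → rightArm t ≤ rightArm s × rightArm s ≤ suc (rightArm t)
rightArm-leftRot (rot a b c)  = n≤1+n _ , ≤-refl
rightArm-leftRot (congˡ t r)  = ≤-refl , n≤1+n _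
rightArm-leftRot (congʳ s r) with rightArm-leftRot r
... | shorter , bounded = s≤s shorter , s≤s bounded

rightArm-rot : ∀ {s t} → Rot s t → rightArm s ≤ suc (rightArm t)
rightArm-rot (left r)  = proj₂ (rightArm-leftRot r)
rightArm-rot (right r) = ≤-trans (proj₁ (rightArm-leftRot r)) (n≤1+n _)

rightArm-rots : ∀ {d s t} → Rots d s t → rightArm s ≤ d + rightArm t
rightArm-rots done       = ≤-refl
rightArm-rots (step r p) = ≤-trans (rightArm-rot r) (s≤s (rightArm-rots p))

rightArm-Rcomb : ∀ n → rightArm (Rcomb n) ≡ n
rightArm-Rcomb zero    = refl
rightArm-Rcomb (suc n) = cong suc (rightArm-Rcomb n)

comb-distance : ∀ m → IsDist (Rcomb (suc m)) (Lcomb (suc m)) m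
comb-distance m = comb-shortcut m , lower-bound
  where
  lower-bound : ∀ d → Rots d (Rcomb (suc m)) (Lcomb (suc m)) → m ≤ d
  lower-bound d p = ≤-pred (≤-trans (subst (_≤ d + 1) (rightArm-Rcomb (suc m)) (rightArm-rots p))
                                    (≤-reflexive (+-comm d 1)))

corollary5p13 : (n : ℕ) → 2 ≤ n →
    Σ Tree λ T → Σ Tree λ T′ → Σ ℕ λ ℓ → Σ ℕ λ d →
      size T ≡ n × size T′ ≡ n × 1 ≤ ℓ × LeftRots ℓ T T′ ×
      IsDist T T′ d × d * n < 12 * ℓ
corollary5p13 zero          ()
corollary5p13 (suc zero)    (s≤s ())
corollary5p13 (suc m@(suc _)) _ =
  Rcomb n , Lcomb n , triangle n , m ,
  size-Rcomb n , size-Lcomb n , triangle-positive , comb-chain n ,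
  comb-distance m , ratio
  where
  n : ℕ
  n = suc m
  -- triangle n ≥ 1, so doubling it is strictly less than multiplying it
  -- by twelve.
  triangle-positive : 1 ≤ triangle n
  triangle-positive = ≤-trans (s≤s z≤n) (m≤n+m m (triangle m))
  ratio : m * n < 12 * triangle n
  ratio = subst (_< 12 * triangle n) (double-triangle m)
                (*-monoˡ-< (triangle n) {{>-nonZero triangle-positive}} (2<12))
    where
    2<12 : 2 < 12
    2<12 = s≤s (s≤s (s≤s z≤n))
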